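{- Let $H$ be an $r$-graph. Then $C_r(n,H)$ is bounded by a constant $C(H)$ (independent of $n$) if and only if $H$ is not $2$-locally large.
   Context: An $r$-graph is an $r$-uniform hypergraph; $K_n^{(r)}$ is the complete $r$-graph on $n$ vertices. For an $r$-graph $H$, an $(n,r,H)$-local coloring with $k$ colors is a family of $n$ edge-colorings $f_v:E(K_n^{(r)})\to[k]$, one for each vertex $v$ of $K_n^{(r)}$, such that for every copy $T$ of $H$ in $K_n^{(r)}$ there is a vertex $u\in V(T)$ for which $f_u$ is rainbow on $T$ (no two edges of $T$ get the same color under $f_u$). $C_r(n,H)$ is the minimum such $k$. 2-locally large: let $H$ be an $r$-graph on $h$ vertices and $\sigma:V(H)\to[h]$ a bijection. For a vertex $x$ and $1\le i\le r$, let $T_x^i$ be the set of edges $e\ni x$ such that $x$ is the $i$-th element of $e$ when the vertices of $e$ are listed in increasing order of $\sigma$; for $r+1\le i\le 2r+1$, let $T_x^i$ be the set of edges $e\not\ni x$ such that $x$ is the $(i-r)$-th element of $e\cup\{x\}$ when listed in increasing order of $\sigma$. Thus $T_x^1,\dots,T_x^{2r+1}$ partition $E(H)$. $H$ is 2-locally large if there is a bijection $\sigma$ such that for every vertex $x\in V(H)$ some $T_x^i$, $i\in[2r+1]$, contains at least two edges. -}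

module Defs where

open import Data.Nat using (ℕ; suc; _+_; _*_; _∸_; _≤_)
open import Data.Bool using (Bool; true)
open import Data.Fin using (Fin; _<_)
open import Data.Fin.Properties using (_<?_)
open import Data.Fin.Subset using (Subset; _∈_; _∉_; _∩_; _∪_; ⁅_⁆; ∣_∣)
open import Data.Vec using (tabulate)
open import Data.Product using (Σ; ∃; _×_; proj₁)
open import Data.Sum using (_⊎_)
open import Function.Bundles using (_⤖_; Bijection)
open import Function.Definitions using (Injective)
open import Relation.Nullary using (¬_; does)
open import Relation.Binary.PropositionalEquality using (_≡_; _≢_)

record RGraph (r h : ℕ) : Set where
  field
    edge    : Subset h → Bool
    uniform : ∀ s → edge s ≡ true → ∣ s ∣ ≡ r
open RGraph public

below : ∀ {h} → (Fin h ⤖ Fin h) → Fin h → Subset h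
below σ x = tabulate (λ y → does (Bijection.to σ y <? Bijection.to σ x))

-- 1-based position of x in S when S is listed in increasing order of σ
pos : ∀ {h} → (Fin h ⤖ Fin h) → Subset h → Fin h → ℕ
pos σ S x = suc ∣ S ∩ below σ x ∣

InT : ∀ {h} (r : ℕ) → (Fin h ⤖ Fin h) → Fin h → ℕ → Subset h → Set
InT r σ x i e =
    (i ≤ r × x ∈ e × pos σ e x ≡ i)
  ⊎ (suc r ≤ i × x ∉ e × pos σ (e ∪ ⁅ x ⁆) x ≡ i ∸ r)

TwoLocallyLarge : ∀ {r h} → RGraph r h → Set
TwoLocallyLarge {r} {h} H =
  Σ (Fin h ⤖ Fin h) λ σ → ∀ (x : Fin h) →
    Σ ℕ λ i → 1 ≤ i × i ≤ 2 * r + 1 ×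
      Σ (Subset h) λ e → Σ (Subset h) λ e′ →
        edge H e ≡ true × edge H e′ ≡ true × e ≢ e′ ×
        InT r σ x i e × InT r σ x i e′

Edge : ℕ → ℕ → Set
Edge n r = Σ (Subset n) λ s → ∣ s ∣ ≡ r

IsImage : ∀ {h n} → (Fin h → Fin n) → Subset h → Subset n → Set
IsImage {h} φ d t =
  ∀ j → ((j ∈ t → ∃ λ (i : Fin h) → i ∈ d × φ i ≡ j)
       × ((∃ λ (i : Fin h) → i ∈ d × φ i ≡ j) → j ∈ t))

InCopy : ∀ {r h n} → RGraph r h → (Fin h → Fin n) → Subset n → Set
InCopy {h = h} H φ t = Σ (Subset h) λ d → edge H d ≡ true × IsImage φ d t

Rainbow : ∀ {r h n k} → RGraph r h → (Fin h → Fin n) → (Edge n r → Fin k) → Set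
Rainbow {r} {n = n} H φ c =
  ∀ (e e′ : Edge n r) → InCopy H φ (proj₁ e) → InCopy H φ (proj₁ e′) →
    proj₁ e ≢ proj₁ e′ → c e ≢ c e′

LocalColoring : ∀ {r h} → ℕ → RGraph r h → ℕ → Set
LocalColoring {r} {h} n H k =
  Σ (Fin n → Edge n r → Fin k) λ f →
    ∀ (φ : Fin h → Fin n) → Injective _≡_ _≡_ φ →
      ∃ λ (x : Fin h) → Rainbow H φ (f (φ x))

{-# OPTIONS --safe #-}
module Submission where

-- For an ordering σ of V(H), a vertex x and an edge e, call the index i with e ∈ T_x^i the slot of
-- e at x.  H is 2-locally large iff some σ has, at every vertex, two edges sharing a slot.
--
-- If H is not 2-locally large, let f_v color an r-set by its slot at v with respect to the natural
-- order of [n] (at most 2r+1 values).  A copy φ of H induces an ordering σ of V(H), and at a vertex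
-- x where all edges of H have distinct slots with respect to σ, f_{φ(x)} is rainbow on the copy.
--
-- Conversely, let H be 2-locally large via σ and suppose C colors suffice for every n.  By Ramsey's
-- theorem, for n large there is a set S of h vertices such that, for each rank a, the color f_v(t)
-- of an r-set t ⊆ S at its a-th vertex v, and the color f_v(U − v) of an (r+1)-set U ⊆ S at its a-th
-- vertex v, do not depend on t resp. U.  Embed H into S in the order σ: two edges of H sharing a
-- slot at x then receive the same color under f_{φ(x)}, so no vertex of the copy is rainbow.

open import Defs
open import Data.Nat using (ℕ; zero; suc; _+_; _*_; _∸_; _≤_; _<_; z≤n; s≤s; s≤s⁻¹; _≤?_)
import Data.Nat as ℕ
import Data.Nat.Properties as ℕ
open import Data.Bool using (true; false)
import Data.Bool as Bool
open import Data.Fin using (Fin; zero; suc; toℕ; fromℕ<; cast)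
import Data.Fin as Fin
open import Data.Fin.Properties
  using (_≟_; any?; <-cmp; <-irrefl; <-asym; <-trans; toℕ<n; toℕ-injective; toℕ-cast; toℕ-fromℕ<; ¬∀⟶∃¬)
  renaming (suc-injective to fsuc-injective)
open import Data.Fin.Subset using (Subset; _∈_; _∉_; _⊆_; _∪_; _∩_; _-_; ⁅_⁆; ∣_∣; inside; outside; ⊤; ⊥)
open import Data.Fin.Subset.Properties
  using ( _∈?_; ⊆-antisym; ⊆-min; anySubset?; drop-there; drop-not-there; ∈⊤; ∣⊤∣≡n; ∣⊥∣≡0
        ; ∣p∣≡n⇒p≡⊤; p⊂q⇒∣p∣<∣q∣; p∩q⊆p; x∈p∩q⁺; x∈p∩q⁻; x∈p∪q⁺; x∈p∪q⁻; x∈⁅x⁆; x∈⁅y⁆⇒x≡y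
        ; ∪-identityʳ; p─⊥≡p )
open import Data.Vec using ([]; _∷_; here; there; tabulate)
open import Data.Vec.Properties using (≡-dec)
open import Data.List using (List; []; _∷_; length; take; map; filter; lookup; allFin)
open import Data.List.Properties using (length-map; length-take; length-tabulate)
open import Data.List.Membership.Propositional using () renaming (_∈_ to _∈ₗ_)
open import Data.List.Membership.Propositional.Properties using (∈-lookup; ∈-filter⁻; ∈-filter⁺)
open import Data.List.Relation.Unary.All as All using (All; []; _∷_)
open import Data.List.Relation.Unary.All.Properties using (all-filter)
import Data.List.Relation.Unary.All.Properties as All
open import Data.List.Relation.Unary.Any.Properties using (lookup-index)
open import Data.List.Relation.Unary.AllPairs using (AllPairs; []; _∷_)
import Data.List.Relation.Unary.AllPairs.Properties as AllPairs
open import Data.List.Relation.Binary.Sublist.Propositional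
  using ([]; _∷_; _∷ʳ_; minimum; ⊆-trans) renaming (_⊆_ to _⊑_)
open import Data.List.Relation.Binary.Sublist.Propositional.Properties
  using (take-⊆; filter-⊆; length-mono-≤; map⁺; All-resp-⊆)
open import Data.Product using (Σ; ∃; _×_; _,_; proj₁; proj₂)
open import Data.Sum using (inj₁; inj₂; [_,_]′)
open import Relation.Nullary using (¬_; Dec; yes; no; ¬?; does; contradiction)
open import Relation.Nullary.Decidable using (_×-dec_; toSum)
open import Relation.Unary using (Decidable)
open import Relation.Binary.Definitions using (tri<; tri≈; tri>)
open import Relation.Binary.PropositionalEquality
  using (_≡_; _≢_; refl; sym; trans; cong; subst; subst₂; module ≡-Reasoning)
open import Function using (_∘_; case_of_)
open import Function.Definitions using (Injective; Surjective)
open import Function.Bundles using (_⤖_; _⇔_; Bijection; Equivalence; mk⤖; mk⇔)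
open import Function.Construct.Identity using (⤖-id)
open Bijection using (to)

-- Ramsey's theorem for sublists

length-take≡ : ∀ {A : Set} m (L : List A) → m ≤ length L → length (take m L) ≡ m
length-take≡ m L m≤L = trans (length-take m L) (ℕ.m≤n⇒m⊓n≡m m≤L)

module _ {A : Set} {c : ℕ} where

  Homogeneous : ℕ → (List A → Fin c) → List A → Set
  Homogeneous k χ S = ∀ {T T′} → T ⊑ S → T′ ⊑ S → length T ≡ k → length T′ ≡ k → χ T ≡ χ T′

  Homogeneous-⊑ : ∀ {k χ S S′} → S′ ⊑ S → Homogeneous k χ S → Homogeneous k χ S′
  Homogeneous-⊑ S′⊑S hom T⊑ T′⊑ = hom (⊆-trans T⊑ S′⊑S) (⊆-trans T′⊑ S′⊑S)

  homogeneous-0 : ∀ χ S → Homogeneous 0 χ S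
  homogeneous-0 χ S {[]} {[]} _ _ _ _ = refl

  data EndHomogeneous (k : ℕ) (χ : List A → Fin c) : List (A × Fin c) → Set where
    [] : EndHomogeneous k χ []
    _∷_ : ∀ {a col P} → (∀ {T} → T ⊑ map proj₁ P → length T ≡ k → χ (a ∷ T) ≡ col) →
          EndHomogeneous k χ P → EndHomogeneous k χ ((a , col) ∷ P)

  EndHomogeneous-⊑ : ∀ {k χ P Q} → Q ⊑ P → EndHomogeneous k χ P → EndHomogeneous k χ Q
  EndHomogeneous-⊑ [] [] = []
  EndHomogeneous-⊑ (_ ∷ʳ Q⊑P) (_ ∷ eh) = EndHomogeneous-⊑ Q⊑P eh
  EndHomogeneous-⊑ (refl ∷ Q⊑P) (ext ∷ eh) =
    (λ T⊑ → ext (⊆-trans T⊑ (map⁺ proj₁ Q⊑P))) ∷ EndHomogeneous-⊑ Q⊑P eh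

  endHomogeneous-monochromatic : ∀ {k χ P} col → EndHomogeneous k χ P → All (λ p → toℕ (proj₂ p) ≡ col) P →
    ∀ {T} → T ⊑ map proj₁ P → length T ≡ suc k → toℕ (χ T) ≡ col
  endHomogeneous-monochromatic col [] [] [] ()
  endHomogeneous-monochromatic col (_ ∷ eh) (_ ∷ mono) (_ ∷ʳ T⊑) len =
    endHomogeneous-monochromatic col eh mono T⊑ len
  endHomogeneous-monochromatic col (ext ∷ _) (colP ∷ _) (refl ∷ T⊑) len =
    trans (cong toℕ (ext T⊑ (ℕ.suc-injective len))) colP

length-filter+length-filter-¬ : ∀ {X : Set} {P : X → Set} (P? : Decidable P) (xs : List X) →
  length (filter P? xs) + length (filter (¬? ∘ P?) xs) ≡ length xs
length-filter+length-filter-¬ P? [] = refl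
length-filter+length-filter-¬ P? (x ∷ xs) with does (P? x)
... | true = cong suc (length-filter+length-filter-¬ P? xs)
... | false = trans (ℕ.+-suc _ _) (cong suc (length-filter+length-filter-¬ P? xs))

pigeonhole : ∀ {X : Set} c m (κ : X → ℕ) (P : List X) → All (λ x → κ x < c) P → c * m < length P →
  Σ ℕ λ col → Σ (List X) λ Q → Q ⊑ P × All (λ x → κ x ≡ col) Q × m ≤ length Q
pigeonhole zero m κ [] [] ()
pigeonhole zero m κ (x ∷ P) (κx<0 ∷ _) _ = contradiction κx<0 ℕ.n≮0
pigeonhole (suc c) m κ P κ<1+c cm<P = case m ≤? length (filter isC? P) of λ where
    (yes m≤) → c , filter isC? P , filter-⊆ isC? P , all-filter isC? P , m≤
    (no m≰) → let col , Q , Q⊑ , mono , m≤Q = pigeonhole c m κ others others<c (others-long (ℕ.≰⇒> m≰))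
              in col , Q , ⊆-trans Q⊑ (filter-⊆ notC? P) , mono , m≤Q
  where
  isC? = λ x → κ x ℕ.≟ c
  notC? = ¬? ∘ isC?
  others = filter notC? P
  others<c : All (λ x → κ x < c) others
  others<c = All.zipWith (λ (κx<1+c , κx≢c) → ℕ.≤∧≢⇒< (s≤s⁻¹ κx<1+c) κx≢c)
    (All.filter⁺ notC? κ<1+c , all-filter notC? P)
  others-long : length (filter isC? P) < m → c * m < length others
  others-long few = ℕ.+-cancelˡ-≤ (length (filter isC? P)) _ _ (begin
    length (filter isC? P) + suc (c * m)   ≡⟨ ℕ.+-suc _ _ ⟩
    suc (length (filter isC? P)) + c * m   ≤⟨ ℕ.+-monoˡ-≤ (c * m) few ⟩
    m + c * m                              <⟨ cm<P ⟩
    length P                               ≡⟨ length-filter+length-filter-¬ isC? P ⟨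
    length (filter isC? P) + length others ∎)
    where open ℕ.≤-Reasoning

ramseyBound endHomogeneousBound : ℕ → ℕ → ℕ → ℕ
ramseyBound zero c m = m
ramseyBound (suc k) c m = endHomogeneousBound k c (suc (c * m))
endHomogeneousBound k c zero = zero
endHomogeneousBound k c (suc j) = suc (ramseyBound k c (endHomogeneousBound k c j))

module _ {A : Set} {c : ℕ} where

  ramsey : ∀ k m (L : List A) → ramseyBound k c m ≤ length L → (χ : List A → Fin c) →
    Σ (List A) λ S → S ⊑ L × length S ≡ m × Homogeneous k χ S

  endHomogeneous : ∀ k j (L : List A) → endHomogeneousBound k c j ≤ length L → (χ : List A → Fin c) →
    Σ (List (A × Fin c)) λ P → map proj₁ P ⊑ L × length P ≡ j × EndHomogeneous k χ P

  ramsey zero m L m≤L χ = take m L , take-⊆ m L , length-take≡ m L m≤L , homogeneous-0 χ _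
  ramsey (suc k) m L bound≤L χ =
    let P , P⊑L , lenP , eh = endHomogeneous k (suc (c * m)) L bound≤L χ
        col , Q , Q⊑P , mono , m≤Q = pigeonhole c m (toℕ ∘ proj₂) P (All.tabulate (λ {p} _ → toℕ<n (proj₂ p)))
                                                 (ℕ.≤-reflexive (sym lenP))
        Q′ = take m Q
        Q′⊑P = ⊆-trans (take-⊆ m Q) Q⊑P
        color≡ = endHomogeneous-monochromatic col (EndHomogeneous-⊑ Q′⊑P eh) (All-resp-⊆ (take-⊆ m Q) mono)
    in map proj₁ Q′ , ⊆-trans (map⁺ proj₁ Q′⊑P) P⊑L , trans (length-map proj₁ Q′) (length-take≡ m Q m≤Q) ,
       λ T⊑ T′⊑ lenT lenT′ → toℕ-injective (trans (color≡ T⊑ lenT) (sym (color≡ T′⊑ lenT′)))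

  endHomogeneous k zero L _ χ = [] , minimum L , refl , []
  endHomogeneous k (suc j) (a ∷ L) (s≤s bound≤L) χ =
    let S , S⊑L , lenS , hom = ramsey k (endHomogeneousBound k c j) L bound≤L (χ ∘ (a ∷_))
        P , P⊑S , lenP , eh = endHomogeneous k j S (ℕ.≤-reflexive (sym lenS)) χ
        ext : ∀ {T} → T ⊑ map proj₁ P → length T ≡ k → χ (a ∷ T) ≡ χ (a ∷ take k S)
        ext T⊑ lenT = hom (⊆-trans T⊑ P⊑S) (take-⊆ k S) lenT
          (length-take≡ k S (subst (_≤ length S) lenT (length-mono-≤ (⊆-trans T⊑ P⊑S))))
    in (a , χ (a ∷ take k S)) ∷ P , refl ∷ ⊆-trans P⊑S S⊑L , cong suc lenP , ext ∷ eh

simultaneousRamseyBound : ℕ → ℕ → ℕ → ℕ → ℕ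
simultaneousRamseyBound k c m zero = m
simultaneousRamseyBound k c m (suc p) = ramseyBound k c (simultaneousRamseyBound k c m p)

simultaneousRamsey : ∀ {A : Set} {c} k m p (L : List A) → simultaneousRamseyBound k c m p ≤ length L →
  (χ : Fin p → List A → Fin c) → Σ (List A) λ S → S ⊑ L × length S ≡ m × (∀ a → Homogeneous k (χ a) S)
simultaneousRamsey k m zero L m≤L χ = take m L , take-⊆ m L , length-take≡ m L m≤L , λ ()
simultaneousRamsey k m (suc p) L bound≤L χ =
  let S₀ , S₀⊑L , lenS₀ , hom₀ = ramsey k _ L bound≤L (χ zero)
      S , S⊑S₀ , lenS , hom = simultaneousRamsey k m p S₀ (ℕ.≤-reflexive (sym lenS₀)) (χ ∘ suc)
  in S , ⊆-trans S⊑S₀ S₀⊑L , lenS , λ where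
       zero → Homogeneous-⊑ S⊑S₀ hom₀
       (suc a) → hom a

-- Finite subsets and their images

subsetOf : ∀ {n} {P : Fin n → Set} → Decidable P → Subset n
subsetOf P? = tabulate (does ∘ P?)

∈-subsetOf⁺ : ∀ {n} {P : Fin n → Set} (P? : Decidable P) {x} → P x → x ∈ subsetOf P?
∈-subsetOf⁺ {suc n} P? {zero} px with P? zero
... | yes _ = here
... | no ¬px = contradiction px ¬px
∈-subsetOf⁺ {suc n} P? {suc x} px = there (∈-subsetOf⁺ (P? ∘ suc) px)

∈-subsetOf⁻ : ∀ {n} {P : Fin n → Set} (P? : Decidable P) {x} → x ∈ subsetOf P? → P x
∈-subsetOf⁻ {suc n} P? {zero} x∈ with P? zero | x∈
... | yes px | _ = px
∈-subsetOf⁻ {suc n} P? {suc x} x∈ = ∈-subsetOf⁻ (P? ∘ suc) (drop-there x∈)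

∣p∪⁅x⁆∣≡1+∣p∣ : ∀ {n} {p : Subset n} {x} → x ∉ p → ∣ p ∪ ⁅ x ⁆ ∣ ≡ suc ∣ p ∣
∣p∪⁅x⁆∣≡1+∣p∣ {p = inside ∷ p} {zero} x∉ = contradiction here x∉
∣p∪⁅x⁆∣≡1+∣p∣ {p = outside ∷ p} {zero} _ = cong (suc ∘ ∣_∣) (∪-identityʳ p)
∣p∪⁅x⁆∣≡1+∣p∣ {p = inside ∷ p} {suc x} x∉ = cong suc (∣p∪⁅x⁆∣≡1+∣p∣ (drop-not-there x∉))
∣p∪⁅x⁆∣≡1+∣p∣ {p = outside ∷ p} {suc x} x∉ = ∣p∪⁅x⁆∣≡1+∣p∣ (drop-not-there x∉)

p∪⁅x⁆-x≡p : ∀ {n} {p : Subset n} {x} → x ∉ p → (p ∪ ⁅ x ⁆) - x ≡ p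
p∪⁅x⁆-x≡p {p = inside ∷ p} {zero} x∉ = contradiction here x∉
p∪⁅x⁆-x≡p {p = outside ∷ p} {zero} _ = cong (outside ∷_) (trans (p─⊥≡p (p ∪ _)) (∪-identityʳ p))
p∪⁅x⁆-x≡p {p = inside ∷ p} {suc x} x∉ = cong (inside ∷_) (p∪⁅x⁆-x≡p (drop-not-there x∉))
p∪⁅x⁆-x≡p {p = outside ∷ p} {suc x} x∉ = cong (outside ∷_) (p∪⁅x⁆-x≡p (drop-not-there x∉))

module _ {h n} (φ : Fin h → Fin n) where

  image : Subset h → Subset n
  image d = subsetOf (λ v → any? (λ x → (x ∈? d) ×-dec (φ x ≟ v)))

  isImage-image : ∀ d → IsImage φ d (image d)
  isImage-image d v = ∈-subsetOf⁻ (λ v → any? (λ x → (x ∈? d) ×-dec (φ x ≟ v))) ,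
                      ∈-subsetOf⁺ (λ v → any? (λ x → (x ∈? d) ×-dec (φ x ≟ v)))

  ∈-image⁺ : ∀ {d x} → x ∈ d → φ x ∈ image d
  ∈-image⁺ {d} {x} x∈d = proj₂ (isImage-image d (φ x)) (x , x∈d , refl)

  ∈-image⁻ : ∀ {d v} → v ∈ image d → ∃ λ x → x ∈ d × φ x ≡ v
  ∈-image⁻ {d} {v} = proj₁ (isImage-image d v)

  isImage⇒≡image : ∀ {d t} → IsImage φ d t → t ≡ image d
  isImage⇒≡image {d} im = ⊆-antisym (λ v∈t → proj₂ (isImage-image d _) (proj₁ (im _) v∈t))
                                     (λ v∈ → proj₂ (im _) (∈-image⁻ v∈))

  image-∪-⁅⁆ : ∀ d x → image (d ∪ ⁅ x ⁆) ≡ image d ∪ ⁅ φ x ⁆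
  image-∪-⁅⁆ d x = ⊆-antisym lhs⊆rhs rhs⊆lhs
    where
    lhs⊆rhs : image (d ∪ ⁅ x ⁆) ⊆ image d ∪ ⁅ φ x ⁆
    lhs⊆rhs v∈ with y , y∈ , refl ← ∈-image⁻ v∈ with x∈p∪q⁻ d ⁅ x ⁆ y∈
    ... | inj₁ y∈d = x∈p∪q⁺ (inj₁ (∈-image⁺ y∈d))
    ... | inj₂ y∈⁅x⁆ rewrite x∈⁅y⁆⇒x≡y x y∈⁅x⁆ = x∈p∪q⁺ (inj₂ (x∈⁅x⁆ (φ x)))
    rhs⊆lhs : image d ∪ ⁅ φ x ⁆ ⊆ image (d ∪ ⁅ x ⁆)
    rhs⊆lhs v∈ with x∈p∪q⁻ (image d) ⁅ φ x ⁆ v∈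
    ... | inj₁ v∈img with y , y∈ , refl ← ∈-image⁻ v∈img = ∈-image⁺ (x∈p∪q⁺ (inj₁ y∈))
    ... | inj₂ v∈⁅φx⁆ rewrite x∈⁅y⁆⇒x≡y (φ x) v∈⁅φx⁆ = ∈-image⁺ (x∈p∪q⁺ (inj₂ (x∈⁅x⁆ x)))

  module _ (φ-injective : Injective _≡_ _≡_ φ) where

    image-reflects-∈ : ∀ {d x} → φ x ∈ image d → x ∈ d
    image-reflects-∈ φx∈ with y , y∈ , φy≡φx ← ∈-image⁻ φx∈ = subst (_∈ _) (φ-injective φy≡φx) y∈

    image-injective : ∀ {d d′} → image d ≡ image d′ → d ≡ d′
    image-injective {d} {d′} eq = ⊆-antisym (into eq) (into (sym eq))
      where
      into : ∀ {d d′} → image d ≡ image d′ → d ⊆ d′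
      into eq x∈ = image-reflects-∈ (subst (_ ∈_) eq (∈-image⁺ x∈))

image-outside∷ : ∀ {h n} (φ : Fin (suc h) → Fin n) d → image φ (outside ∷ d) ≡ image (φ ∘ suc) d
image-outside∷ φ d = ⊆-antisym lhs⊆rhs rhs⊆lhs
  where
  lhs⊆rhs : image φ (outside ∷ d) ⊆ image (φ ∘ suc) d
  lhs⊆rhs v∈ with ∈-image⁻ φ {outside ∷ d} v∈
  ... | zero , () , _
  ... | suc y , y∈ , refl = ∈-image⁺ (φ ∘ suc) (drop-there y∈)
  rhs⊆lhs : image (φ ∘ suc) d ⊆ image φ (outside ∷ d)
  rhs⊆lhs v∈ with y , y∈ , refl ← ∈-image⁻ (φ ∘ suc) {d} v∈ = ∈-image⁺ φ {outside ∷ d} (there y∈)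

∣image∣ : ∀ {h n} {φ : Fin h → Fin n} → Injective _≡_ _≡_ φ → ∀ d → ∣ image φ d ∣ ≡ ∣ d ∣
∣image∣ {zero} {n} {φ} _ [] = trans (cong ∣_∣ image≡⊥) (∣⊥∣≡0 n)
  where
  image≡⊥ : image φ [] ≡ ⊥
  image≡⊥ = ⊆-antisym (λ v∈ → case ∈-image⁻ φ {[]} v∈ of λ ()) (⊆-min _)
∣image∣ {suc h} {φ = φ} φ-injective (outside ∷ d) =
  trans (cong ∣_∣ (image-outside∷ φ d)) (∣image∣ (fsuc-injective ∘ φ-injective) d)
∣image∣ {suc h} {φ = φ} φ-injective (inside ∷ d) = begin
  ∣ image φ (inside ∷ d) ∣               ≡⟨ cong (∣_∣ ∘ image φ ∘ (inside ∷_)) (∪-identityʳ d) ⟨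
  ∣ image φ ((outside ∷ d) ∪ ⁅ zero ⁆) ∣ ≡⟨ cong ∣_∣ (image-∪-⁅⁆ φ (outside ∷ d) zero) ⟩
  ∣ image φ (outside ∷ d) ∪ ⁅ φ zero ⁆ ∣ ≡⟨ ∣p∪⁅x⁆∣≡1+∣p∣ φ0∉ ⟩
  suc ∣ image φ (outside ∷ d) ∣          ≡⟨ cong (suc ∘ ∣_∣) (image-outside∷ φ d) ⟩
  suc ∣ image (φ ∘ suc) d ∣              ≡⟨ cong suc (∣image∣ (fsuc-injective ∘ φ-injective) d) ⟩
  suc ∣ d ∣                              ∎
  where
  open ≡-Reasoning
  φ0∉ : φ zero ∉ image φ (outside ∷ d)
  φ0∉ φ0∈ = case image-reflects-∈ φ φ-injective {outside ∷ d} φ0∈ of λ ()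

injective⇒surjective : ∀ {h} {f : Fin h → Fin h} → Injective _≡_ _≡_ f → Surjective _≡_ _≡_ f
injective⇒surjective {h} {f} f-injective y =
  let x , _ , fx≡y = ∈-image⁻ f (subst (y ∈_) (sym image≡⊤) ∈⊤) in x , λ { refl → fx≡y }
  where
  image≡⊤ : image f ⊤ ≡ ⊤
  image≡⊤ = ∣p∣≡n⇒p≡⊤ (trans (∣image∣ f-injective ⊤) (∣⊤∣≡n h))

-- Positions and slots

id⤖ : ∀ {n} → Fin n ⤖ Fin n
id⤖ = ⤖-id _

rank : ∀ {n} → Subset n → Fin n → ℕ
rank U v = ∣ U ∩ below id⤖ v ∣

module _ {h} (σ : Fin h ⤖ Fin h) where

  ∈-below⁺ : ∀ {x y} → to σ y Fin.< to σ x → y ∈ below σ x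
  ∈-below⁺ {x} = ∈-subsetOf⁺ (λ y → to σ y Fin.<? to σ x)

  ∈-below⁻ : ∀ {x y} → y ∈ below σ x → to σ y Fin.< to σ x
  ∈-below⁻ {x} = ∈-subsetOf⁻ (λ y → to σ y Fin.<? to σ x)

  pos≤∣∣ : ∀ {e x} → x ∈ e → pos σ e x ≤ ∣ e ∣
  pos≤∣∣ {e} x∈e =
    p⊂q⇒∣p∣<∣q∣ (p∩q⊆p e _ , _ , x∈e , λ x∈ → <-irrefl refl (∈-below⁻ (proj₂ (x∈p∩q⁻ e _ x∈))))

module _ {n} {U : Subset n} where

  rank-< : ∀ {v w} → v ∈ U → v Fin.< w → rank U v < rank U w
  rank-< {v} {w} v∈U v<w = p⊂q⇒∣p∣<∣q∣ (below-v⊆below-w , v , x∈p∩q⁺ (v∈U , ∈-below⁺ id⤖ v<w) , v∉below-v)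
    where
    below-v⊆below-w : U ∩ below id⤖ v ⊆ U ∩ below id⤖ w
    below-v⊆below-w z∈ =
      let z∈U , z<v = x∈p∩q⁻ U _ z∈ in x∈p∩q⁺ (z∈U , ∈-below⁺ id⤖ (<-trans (∈-below⁻ id⤖ z<v) v<w))
    v∉below-v : v ∉ U ∩ below id⤖ v
    v∉below-v v∈ = <-irrefl refl (∈-below⁻ id⤖ (proj₂ (x∈p∩q⁻ U _ v∈)))

  rank-injective : ∀ {v w} → v ∈ U → w ∈ U → rank U v ≡ rank U w → v ≡ w
  rank-injective {v} {w} v∈U w∈U eq with <-cmp v w
  ... | tri< v<w _ _ = contradiction eq (ℕ.<⇒≢ (rank-< v∈U v<w))
  ... | tri≈ _ v≡w _ = v≡w
  ... | tri> _ _ w<v = contradiction (sym eq) (ℕ.<⇒≢ (rank-< w∈U w<v))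

  rank-reflects : ∀ {v w} → v ∈ U → w ∈ U → rank U v < rank U w → v Fin.< w
  rank-reflects {v} {w} v∈U w∈U lt with <-cmp v w
  ... | tri< v<w _ _ = v<w
  ... | tri≈ _ refl _ = contradiction lt (ℕ.<-irrefl refl)
  ... | tri> _ _ w<v = contradiction lt (ℕ.<-asym (rank-< w∈U w<v))

-- Junk value zero when U has no element of rank a.
atRank : ∀ {n c} → Subset n → ℕ → (Fin n → Fin (suc c)) → Fin (suc c)
atRank U a g with any? (λ v → (v ∈? U) ×-dec (rank U v ℕ.≟ a))
... | yes (v , _) = g v
... | no _ = zero

atRank≡ : ∀ {n c} {U : Subset n} {g : Fin n → Fin (suc c)} {v a} → v ∈ U → rank U v ≡ a → atRank U a g ≡ g v
atRank≡ {U = U} {g} {v} {a} v∈U rank≡a with any? (λ v → (v ∈? U) ×-dec (rank U v ℕ.≟ a))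
... | yes (w , w∈U , rank≡a′) = cong g (rank-injective w∈U v∈U (trans rank≡a′ (sym rank≡a)))
... | no none = contradiction (v , v∈U , rank≡a) none

slot : ∀ {h} → ℕ → Fin h ⤖ Fin h → Fin h → Subset h → ℕ
slot r σ x e with x ∈? e
... | yes _ = pos σ e x
... | no _ = r + pos σ (e ∪ ⁅ x ⁆) x

module _ {h} {r : ℕ} {σ : Fin h ⤖ Fin h} {x : Fin h} where

  slot-∈ : ∀ {e} → x ∈ e → slot r σ x e ≡ pos σ e x
  slot-∈ {e} x∈e with x ∈? e
  ... | yes _ = refl
  ... | no x∉e = contradiction x∈e x∉e

  slot-∉ : ∀ {e} → x ∉ e → slot r σ x e ≡ r + pos σ (e ∪ ⁅ x ⁆) x
  slot-∉ {e} x∉e with x ∈? e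
  ... | yes x∈e = contradiction x∈e x∉e
  ... | no _ = refl

  pos≤r : ∀ {e} → ∣ e ∣ ≡ r → x ∈ e → pos σ e x ≤ r
  pos≤r {e} ∣e∣≡r x∈e = subst (pos σ e x ≤_) ∣e∣≡r (pos≤∣∣ σ x∈e)

  pos-∪⁅x⁆≤1+r : ∀ {e} → ∣ e ∣ ≡ r → x ∉ e → pos σ (e ∪ ⁅ x ⁆) x ≤ suc r
  pos-∪⁅x⁆≤1+r {e} ∣e∣≡r x∉e =
    subst (pos σ (e ∪ ⁅ x ⁆) x ≤_) (trans (∣p∪⁅x⁆∣≡1+∣p∣ x∉e) (cong suc ∣e∣≡r))
          (pos≤∣∣ σ {e ∪ ⁅ x ⁆} (x∈p∪q⁺ (inj₂ (x∈⁅x⁆ x))))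

  slot≡⇒∈ : ∀ {e e′} → ∣ e ∣ ≡ r → slot r σ x e ≡ slot r σ x e′ → x ∈ e → x ∈ e′
  slot≡⇒∈ {e} {e′} ∣e∣≡r slot≡ x∈e with x ∈? e′
  ... | yes x∈e′ = x∈e′
  ... | no _ = contradiction (subst (_≤ r) (trans (sym (slot-∈ x∈e)) slot≡) (pos≤r ∣e∣≡r x∈e))
                             (ℕ.<⇒≱ (ℕ.m<m+n r (s≤s z≤n)))

  InT-slot : ∀ {e} → ∣ e ∣ ≡ r → InT r σ x (slot r σ x e) e
  InT-slot {e} ∣e∣≡r with x ∈? e
  ... | yes x∈e = inj₁ (pos≤r ∣e∣≡r x∈e , x∈e , refl)
  ... | no x∉e = inj₂ (ℕ.m<m+n r (s≤s z≤n) , x∉e , sym (ℕ.m+n∸m≡n r _))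

  InT⇒slot : ∀ {e i} → InT r σ x i e → slot r σ x e ≡ i
  InT⇒slot (inj₁ (_ , x∈e , pos≡i)) = trans (slot-∈ x∈e) pos≡i
  InT⇒slot (inj₂ (r<i , x∉e , pos≡i∸r)) =
    trans (slot-∉ x∉e) (trans (cong (r +_) pos≡i∸r) (ℕ.m+[n∸m]≡n (ℕ.<⇒≤ r<i)))

  slot-bounds : ∀ {e} → ∣ e ∣ ≡ r → 1 ≤ slot r σ x e × slot r σ x e ≤ 2 * r + 1
  slot-bounds {e} ∣e∣≡r with x ∈? e
  ... | yes x∈e = s≤s z≤n , ℕ.≤-trans (pos≤r ∣e∣≡r x∈e) (ℕ.≤-trans (ℕ.m≤m+n r (r + 0)) (ℕ.m≤m+n (2 * r) 1))
  ... | no x∉e = ℕ.≤-trans (s≤s z≤n) (ℕ.m≤n+m _ r) , (begin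
    r + pos σ (e ∪ ⁅ x ⁆) x  ≤⟨ ℕ.+-monoʳ-≤ r (pos-∪⁅x⁆≤1+r ∣e∣≡r x∉e) ⟩
    r + suc r                ≡⟨ ℕ.+-suc r r ⟩
    suc (r + r)              ≡⟨ cong (λ m → suc (r + m)) (ℕ.+-identityʳ r) ⟨
    1 + 2 * r                ≡⟨ ℕ.+-comm 1 (2 * r) ⟩
    2 * r + 1                ∎)
    where open ℕ.≤-Reasoning

module _ {r h} (H : RGraph r h) where

  SlotCollision : Fin h ⤖ Fin h → Fin h → Set
  SlotCollision σ x = Σ (Subset h) λ e → Σ (Subset h) λ e′ →
    edge H e ≡ true × edge H e′ ≡ true × e ≢ e′ × slot r σ x e ≡ slot r σ x e′

  slotCollision? : ∀ σ x → Dec (SlotCollision σ x)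
  slotCollision? σ x = anySubset? λ e → anySubset? λ e′ →
    (edge H e Bool.≟ true) ×-dec (edge H e′ Bool.≟ true) ×-dec ¬? (≡-dec Bool._≟_ e e′) ×-dec
    (slot r σ x e ℕ.≟ slot r σ x e′)

  twoLocallyLarge⇔slotCollisions : TwoLocallyLarge H ⇔ (Σ (Fin h ⤖ Fin h) λ σ → ∀ x → SlotCollision σ x)
  twoLocallyLarge⇔slotCollisions = mk⇔ collisions large
    where
    collisions : TwoLocallyLarge H → Σ (Fin h ⤖ Fin h) λ σ → ∀ x → SlotCollision σ x
    collisions (σ , twoInSomeT) = σ , λ x →
      let _ , _ , _ , e , e′ , ee , ee′ , e≢e′ , e∈Tᵢ , e′∈Tᵢ = twoInSomeT x
      in e , e′ , ee , ee′ , e≢e′ , trans (InT⇒slot e∈Tᵢ) (sym (InT⇒slot e′∈Tᵢ))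
    large : (Σ (Fin h ⤖ Fin h) λ σ → ∀ x → SlotCollision σ x) → TwoLocallyLarge H
    large (σ , collision) = σ , λ x →
      let e , e′ , ee , ee′ , e≢e′ , slot≡ = collision x
          1≤i , i≤2r+1 = slot-bounds {σ = σ} {x} {e} (uniform H e ee)
      in slot r σ x e , 1≤i , i≤2r+1 , e , e′ , ee , ee′ , e≢e′ , InT-slot (uniform H e ee) ,
         subst (λ i → InT r σ x i e′) (sym slot≡) (InT-slot (uniform H e′ ee′))

-- Order embeddings

Increasing : ∀ {h n} → Fin h ⤖ Fin h → (Fin h → Fin n) → Set
Increasing σ φ = ∀ {x y} → to σ y Fin.< to σ x → φ y Fin.< φ x

module OrderEmbedding {h n} (σ : Fin h ⤖ Fin h) (φ : Fin h → Fin n) (φ-increasing : Increasing σ φ) where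

  injective : Injective _≡_ _≡_ φ
  injective {x} {y} φx≡φy with <-cmp (to σ x) (to σ y)
  ... | tri< σx<σy _ _ = contradiction (φ-increasing σx<σy) (<-irrefl φx≡φy)
  ... | tri≈ _ σx≡σy _ = Bijection.injective σ σx≡σy
  ... | tri> _ _ σy<σx = contradiction (φ-increasing σy<σx) (<-irrefl (sym φx≡φy))

  reflects : ∀ {x y} → φ y Fin.< φ x → to σ y Fin.< to σ x
  reflects {x} {y} φy<φx with <-cmp (to σ y) (to σ x)
  ... | tri< σy<σx _ _ = σy<σx
  ... | tri≈ _ σy≡σx _ = contradiction φy<φx (<-irrefl (cong φ (Bijection.injective σ σy≡σx)))
  ... | tri> _ _ σx<σy = contradiction φy<φx (<-asym (φ-increasing σx<σy))

  image-∩-below : ∀ d x → image φ d ∩ below id⤖ (φ x) ≡ image φ (d ∩ below σ x)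
  image-∩-below d x = ⊆-antisym lhs⊆rhs rhs⊆lhs
    where
    lhs⊆rhs : image φ d ∩ below id⤖ (φ x) ⊆ image φ (d ∩ below σ x)
    lhs⊆rhs v∈ with v∈img , v<φx ← x∈p∩q⁻ (image φ d) _ v∈ with y , y∈d , refl ← ∈-image⁻ φ v∈img =
      ∈-image⁺ φ (x∈p∩q⁺ (y∈d , ∈-below⁺ σ (reflects (∈-below⁻ id⤖ v<φx))))
    rhs⊆lhs : image φ (d ∩ below σ x) ⊆ image φ d ∩ below id⤖ (φ x)
    rhs⊆lhs v∈ with y , y∈ , refl ← ∈-image⁻ φ v∈ with y∈d , y<x ← x∈p∩q⁻ d _ y∈ =
      x∈p∩q⁺ (∈-image⁺ φ y∈d , ∈-below⁺ id⤖ (φ-increasing (∈-below⁻ σ y<x)))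

  rank-image : ∀ d x → rank (image φ d) (φ x) ≡ ∣ d ∩ below σ x ∣
  rank-image d x = trans (cong ∣_∣ (image-∩-below d x)) (∣image∣ injective (d ∩ below σ x))

  slot-image : ∀ {r} d x → slot r id⤖ (φ x) (image φ d) ≡ slot r σ x d
  slot-image {r} d x with x ∈? d
  ... | yes x∈d = trans (slot-∈ {r = r} (∈-image⁺ φ x∈d)) (cong suc (rank-image d x))
  ... | no x∉d = begin
    slot r id⤖ (φ x) (image φ d)            ≡⟨ slot-∉ (x∉d ∘ image-reflects-∈ φ injective {d}) ⟩
    r + pos id⤖ (image φ d ∪ ⁅ φ x ⁆) (φ x) ≡⟨ cong (λ U → r + pos id⤖ U (φ x)) (image-∪-⁅⁆ φ d x) ⟨
    r + pos id⤖ (image φ (d ∪ ⁅ x ⁆)) (φ x) ≡⟨ cong (λ m → r + suc m) (rank-image (d ∪ ⁅ x ⁆) x) ⟩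
    r + pos σ (d ∪ ⁅ x ⁆) x                 ∎
    where open ≡-Reasoning

module _ {h n} {φ : Fin h → Fin n} (φ-injective : Injective _≡_ _≡_ φ) where

  private
    φ[h] = image φ ⊤

    φy∈φ[h] : ∀ y → φ y ∈ φ[h]
    φy∈φ[h] y = ∈-image⁺ φ ∈⊤

    rank<h : ∀ y → rank φ[h] (φ y) < h
    rank<h y = subst (rank φ[h] (φ y) <_) (trans (∣image∣ φ-injective ⊤) (∣⊤∣≡n h)) (pos≤∣∣ id⤖ (φy∈φ[h] y))

    inducedRank : Fin h → Fin h
    inducedRank y = fromℕ< (rank<h y)

    toℕ-inducedRank : ∀ y → toℕ (inducedRank y) ≡ rank φ[h] (φ y)
    toℕ-inducedRank y = toℕ-fromℕ< (rank<h y)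

    inducedRank-injective : Injective _≡_ _≡_ inducedRank
    inducedRank-injective {x} {y} eq = φ-injective (rank-injective (φy∈φ[h] x) (φy∈φ[h] y)
      (trans (sym (toℕ-inducedRank x)) (trans (cong toℕ eq) (toℕ-inducedRank y))))

  inducedOrder : Fin h ⤖ Fin h
  inducedOrder = mk⤖ (inducedRank-injective , injective⇒surjective inducedRank-injective)

  inducedOrder-increasing : Increasing inducedOrder φ
  inducedOrder-increasing {x} {y} σy<σx = rank-reflects (φy∈φ[h] y) (φy∈φ[h] x)
    (subst₂ _<_ (toℕ-inducedRank y) (toℕ-inducedRank x) σy<σx)

-- Sorted lists as subsets

Sorted : ∀ {n} → List (Fin n) → Set
Sorted = AllPairs Fin._<_

allFin-sorted : ∀ n → Sorted (allFin n)
allFin-sorted n = AllPairs.tabulate⁺-< (λ i<j → i<j)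

AllPairs-⊑ : ∀ {A : Set} {R : A → A → Set} {xs ys} → xs ⊑ ys → AllPairs R ys → AllPairs R xs
AllPairs-⊑ [] [] = []
AllPairs-⊑ (_ ∷ʳ τ) (_ ∷ pys) = AllPairs-⊑ τ pys
AllPairs-⊑ (refl ∷ τ) (px ∷ pys) = All-resp-⊆ τ px ∷ AllPairs-⊑ τ pys

lookup-increasing : ∀ {n} {xs : List (Fin n)} → Sorted xs → Increasing id⤖ (lookup xs)
lookup-increasing {xs = _ ∷ _} (x<xs ∷ _) {suc i} {zero} _ = All.lookup x<xs (∈-lookup i)
lookup-increasing {xs = _ ∷ _} (_ ∷ sorted) {suc i} {suc j} (s≤s j<i) = lookup-increasing sorted j<i

toSubset : ∀ {n} → List (Fin n) → Subset n
toSubset xs = image (lookup xs) ⊤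

∈-toSubset⁺ : ∀ {n} {xs : List (Fin n)} {v} → v ∈ₗ xs → v ∈ toSubset xs
∈-toSubset⁺ {xs = xs} v∈xs = subst (_∈ toSubset xs) (sym (lookup-index v∈xs)) (∈-image⁺ (lookup xs) ∈⊤)

∈-toSubset⁻ : ∀ {n} {xs : List (Fin n)} {v} → v ∈ toSubset xs → v ∈ₗ xs
∈-toSubset⁻ {xs = xs} v∈ with i , _ , refl ← ∈-image⁻ (lookup xs) v∈ = ∈-lookup i

∣toSubset∣ : ∀ {n} {xs : List (Fin n)} → Sorted xs → ∣ toSubset xs ∣ ≡ length xs
∣toSubset∣ {xs = xs} sorted =
  trans (∣image∣ (OrderEmbedding.injective id⤖ (lookup xs) (lookup-increasing sorted)) ⊤) (∣⊤∣≡n (length xs))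

sublistWithElements : ∀ {n} {S : List (Fin n)} → Sorted S → ∀ {X} → X ⊆ toSubset S →
  Σ (List (Fin n)) λ T → T ⊑ S × toSubset T ≡ X × length T ≡ ∣ X ∣
sublistWithElements {S = S} sorted {X} X⊆S =
  T , filter-⊆ (_∈? X) S , T≡X , trans (sym (∣toSubset∣ (AllPairs.filter⁺ (_∈? X) sorted))) (cong ∣_∣ T≡X)
  where
  T = filter (_∈? X) S
  T≡X : toSubset T ≡ X
  T≡X = ⊆-antisym (λ v∈T → proj₂ (∈-filter⁻ (_∈? X) {xs = S} (∈-toSubset⁻ {xs = T} v∈T)))
                  (λ v∈X → ∈-toSubset⁺ (∈-filter⁺ (_∈? X) (∈-toSubset⁻ {xs = S} (X⊆S v∈X)) v∈X))

homogeneous-toSubset : ∀ {n c k} {χ : Subset n → Fin c} {S} → Sorted S → Homogeneous k (χ ∘ toSubset) S →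
  ∀ {X X′} → X ⊆ toSubset S → X′ ⊆ toSubset S → ∣ X ∣ ≡ k → ∣ X′ ∣ ≡ k → χ X ≡ χ X′
homogeneous-toSubset {χ = χ} sorted hom X⊆S X′⊆S ∣X∣≡k ∣X′∣≡k =
  let T , T⊑S , T≡X , ∣T∣≡∣X∣ = sublistWithElements sorted X⊆S
      T′ , T′⊑S , T′≡X′ , ∣T′∣≡∣X′∣ = sublistWithElements sorted X′⊆S
  in subst₂ (λ Y Y′ → χ Y ≡ χ Y′) T≡X T′≡X′ (hom T⊑S T′⊑S (trans ∣T∣≡∣X∣ ∣X∣≡k) (trans ∣T′∣≡∣X′∣ ∣X′∣≡k))

-- Few colors suffice when H is not 2-locally large

slotColoring : ∀ {n} r → Fin n → Edge n r → Fin (suc (2 * r + 1))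
slotColoring r v (t , ∣t∣≡r) = fromℕ< (s≤s (proj₂ (slot-bounds {σ = id⤖} {v} {t} ∣t∣≡r)))

toℕ-slotColoring : ∀ {n r} v (t : Subset n) (∣t∣≡r : ∣ t ∣ ≡ r) →
  toℕ (slotColoring r v (t , ∣t∣≡r)) ≡ slot r id⤖ v t
toℕ-slotColoring v t ∣t∣≡r = toℕ-fromℕ< _

module _ {r h} (H : RGraph r h) (notLarge : ¬ TwoLocallyLarge H) where

  slotColoring-local : ∀ n → LocalColoring n H (suc (2 * r + 1))
  slotColoring-local n = slotColoring r , rainbowVertex
    where
    rainbowVertex : ∀ (φ : Fin h → Fin n) → Injective _≡_ _≡_ φ → ∃ λ x → Rainbow H φ (slotColoring r (φ x))
    rainbowVertex φ φ-injective = x , rainbow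
      where
      σ = inducedOrder φ-injective
      open OrderEmbedding σ φ (inducedOrder-increasing φ-injective)

      noCollisionSomewhere : ∃ λ x → ¬ SlotCollision H σ x
      noCollisionSomewhere = ¬∀⟶∃¬ h _ (slotCollision? H σ)
        (λ collision → notLarge (Equivalence.from (twoLocallyLarge⇔slotCollisions H) (σ , collision)))

      x = proj₁ noCollisionSomewhere

      slot≡color : ∀ {d t} → IsImage φ d t → (∣t∣≡r : ∣ t ∣ ≡ r) →
        slot r σ x d ≡ toℕ (slotColoring r (φ x) (t , ∣t∣≡r))
      slot≡color {d} {t} t=φd ∣t∣≡r = begin
        slot r σ x d                            ≡⟨ slot-image d x ⟨
        slot r id⤖ (φ x) (image φ d)            ≡⟨ cong (slot r id⤖ (φ x)) (isImage⇒≡image φ t=φd) ⟨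
        slot r id⤖ (φ x) t                      ≡⟨ toℕ-slotColoring (φ x) t ∣t∣≡r ⟨
        toℕ (slotColoring r (φ x) (t , ∣t∣≡r)) ∎
        where open ≡-Reasoning

      rainbow : Rainbow H φ (slotColoring r (φ x))
      rainbow (t , ∣t∣≡r) (t′ , ∣t′∣≡r) (d , ed , t=φd) (d′ , ed′ , t′=φd′) t≢t′ sameColor =
        proj₂ noCollisionSomewhere (d , d′ , ed , ed′ , d≢d′ ,
          trans (slot≡color t=φd ∣t∣≡r) (trans (cong toℕ sameColor) (sym (slot≡color t′=φd′ ∣t′∣≡r))))
        where
        d≢d′ : d ≢ d′
        d≢d′ refl = t≢t′ (trans (isImage⇒≡image φ t=φd) (sym (isImage⇒≡image φ t′=φd′)))

-- Many colors are needed when H is 2-locally large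

-- Genuine colors are shifted by suc; zero is a junk color for subsets of the wrong size.
module _ {r n C} (f : Fin n → Edge n r → Fin C) where

  subsetColor : Fin n → Subset n → Fin (suc C)
  subsetColor v t with ∣ t ∣ ℕ.≟ r
  ... | yes ∣t∣≡r = suc (f v (t , ∣t∣≡r))
  ... | no _ = zero

  subsetColor-edge : ∀ v t (∣t∣≡r : ∣ t ∣ ≡ r) → subsetColor v t ≡ suc (f v (t , ∣t∣≡r))
  subsetColor-edge v t ∣t∣≡r with ∣ t ∣ ℕ.≟ r
  ... | yes p = cong (λ p → suc (f v (t , p))) (ℕ.≡-irrelevant p ∣t∣≡r)
  ... | no ∣t∣≢r = contradiction ∣t∣≡r ∣t∣≢r

  insideColoring : Fin r → Subset n → Fin (suc C)
  insideColoring a U = atRank U (toℕ a) (λ v → subsetColor v U)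

  outsideColoring : Fin (suc r) → Subset n → Fin (suc C)
  outsideColoring a U = atRank U (toℕ a) (λ v → subsetColor v (U - v))

localRamseyNumber : ℕ → ℕ → ℕ → ℕ
localRamseyNumber r C h =
  simultaneousRamseyBound r (suc C) (simultaneousRamseyBound (suc r) (suc C) h (suc r)) r

homogeneousSet : ∀ {r C} h (let N = localRamseyNumber r C h) (f : Fin N → Edge N r → Fin C) →
  Σ (List (Fin N)) λ S → Sorted S × length S ≡ h ×
    (∀ a → Homogeneous r (insideColoring f a ∘ toSubset) S) ×
    (∀ a → Homogeneous (suc r) (outsideColoring f a ∘ toSubset) S)
homogeneousSet {r} {C} h f =
  let S₁ , S₁⊑ , ∣S₁∣ , hom₁ = simultaneousRamsey r _ r (allFin N) (ℕ.≤-reflexive (sym (length-tabulate _)))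
                                (λ a → insideColoring f a ∘ toSubset)
      S , S⊑S₁ , ∣S∣ , hom = simultaneousRamsey (suc r) h (suc r) S₁ (ℕ.≤-reflexive (sym ∣S₁∣))
                               (λ a → outsideColoring f a ∘ toSubset)
  in S , AllPairs-⊑ (⊆-trans S⊑S₁ S₁⊑) (allFin-sorted N) , ∣S∣ , (λ a → Homogeneous-⊑ S⊑S₁ (hom₁ a)) , hom
  where N = localRamseyNumber r C h

module HomogeneousEmbedding {r h n C} (H : RGraph r h) (f : Fin n → Edge n r → Fin C)
  {S : List (Fin n)} (sorted : Sorted S) (∣S∣≡h : length S ≡ h)
  (homInside : ∀ a → Homogeneous r (insideColoring f a ∘ toSubset) S)
  (homOutside : ∀ a → Homogeneous (suc r) (outsideColoring f a ∘ toSubset) S)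
  (σ : Fin h ⤖ Fin h) where

  φ : Fin h → Fin n
  φ = lookup S ∘ cast (sym ∣S∣≡h) ∘ to σ

  φ-increasing : Increasing σ φ
  φ-increasing {x} {y} σy<σx = lookup-increasing sorted
    (subst₂ _<_ (sym (toℕ-cast _ (to σ y))) (sym (toℕ-cast _ (to σ x))) σy<σx)

  open OrderEmbedding σ φ φ-increasing public

  image⊆S : ∀ d → image φ d ⊆ toSubset S
  image⊆S d v∈ with _ , _ , refl ← ∈-image⁻ φ {d} v∈ = ∈-image⁺ (lookup S) ∈⊤

  edgeImage : ∀ d → edge H d ≡ true → Edge n r
  edgeImage d ed = image φ d , trans (∣image∣ injective d) (uniform H d ed)

  ∣image-∪⁅x⁆∣ : ∀ {x e} → edge H e ≡ true → x ∉ e → ∣ image φ (e ∪ ⁅ x ⁆) ∣ ≡ suc r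
  ∣image-∪⁅x⁆∣ {x} {e} ee x∉e =
    trans (∣image∣ injective (e ∪ ⁅ x ⁆)) (trans (∣p∪⁅x⁆∣≡1+∣p∣ x∉e) (cong suc (uniform H e ee)))

  insideColoring-image : ∀ {x e} (ee : edge H e ≡ true) → x ∈ e → ∀ a → ∣ e ∩ below σ x ∣ ≡ toℕ a →
    insideColoring f a (image φ e) ≡ suc (f (φ x) (edgeImage e ee))
  insideColoring-image {x} {e} ee x∈e a ≡a =
    trans (atRank≡ (∈-image⁺ φ x∈e) (trans (rank-image e x) ≡a)) (subsetColor-edge f (φ x) (image φ e) _)

  outsideColoring-image : ∀ {x e} (ee : edge H e ≡ true) → x ∉ e → ∀ a → ∣ (e ∪ ⁅ x ⁆) ∩ below σ x ∣ ≡ toℕ a →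
    outsideColoring f a (image φ (e ∪ ⁅ x ⁆)) ≡ suc (f (φ x) (edgeImage e ee))
  outsideColoring-image {x} {e} ee x∉e a ≡a = begin
    outsideColoring f a (image φ (e ∪ ⁅ x ⁆))       ≡⟨ atRank≡ (∈-image⁺ φ (x∈p∪q⁺ (inj₂ (x∈⁅x⁆ x))))
                                                               (trans (rank-image (e ∪ ⁅ x ⁆) x) ≡a) ⟩
    subsetColor f (φ x) (image φ (e ∪ ⁅ x ⁆) - φ x) ≡⟨ cong (subsetColor f (φ x)) image-x ⟩
    subsetColor f (φ x) (image φ e)                 ≡⟨ subsetColor-edge f (φ x) (image φ e) _ ⟩
    suc (f (φ x) (edgeImage e ee))                  ∎
    where
    open ≡-Reasoning
    image-x : image φ (e ∪ ⁅ x ⁆) - φ x ≡ image φ e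
    image-x = trans (cong (_- φ x) (image-∪-⁅⁆ φ e x)) (p∪⁅x⁆-x≡p (x∉e ∘ image-reflects-∈ φ injective {e}))

  module _ {x e e′} (ee : edge H e ≡ true) (ee′ : edge H e′ ≡ true)
           (slot≡ : slot r σ x e ≡ slot r σ x e′) where

    sameColor-∈ : x ∈ e → f (φ x) (edgeImage e ee) ≡ f (φ x) (edgeImage e′ ee′)
    sameColor-∈ x∈e = fsuc-injective (begin
      suc (f (φ x) (edgeImage e ee))   ≡⟨ insideColoring-image ee x∈e a (sym (toℕ-fromℕ< _)) ⟨
      insideColoring f a (image φ e)   ≡⟨ homogeneous-toSubset {χ = insideColoring f a} sorted (homInside a)
                                            (image⊆S e) (image⊆S e′)
                                            (proj₂ (edgeImage e ee)) (proj₂ (edgeImage e′ ee′)) ⟩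
      insideColoring f a (image φ e′)  ≡⟨ insideColoring-image ee′ x∈e′ a
                                            (trans pos′≡pos (sym (toℕ-fromℕ< _))) ⟩
      suc (f (φ x) (edgeImage e′ ee′)) ∎)
      where
      open ≡-Reasoning
      x∈e′ = slot≡⇒∈ {σ = σ} (uniform H e ee) slot≡ x∈e
      a = fromℕ< (pos≤r {σ = σ} (uniform H e ee) x∈e)
      pos′≡pos : ∣ e′ ∩ below σ x ∣ ≡ ∣ e ∩ below σ x ∣
      pos′≡pos = ℕ.suc-injective (trans (sym (slot-∈ {σ = σ} x∈e′)) (trans (sym slot≡) (slot-∈ x∈e)))

    sameColor-∉ : x ∉ e → f (φ x) (edgeImage e ee) ≡ f (φ x) (edgeImage e′ ee′)
    sameColor-∉ x∉e = fsuc-injective (begin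
      suc (f (φ x) (edgeImage e ee))              ≡⟨ outsideColoring-image ee x∉e a (sym (toℕ-fromℕ< _)) ⟨
      outsideColoring f a (image φ (e ∪ ⁅ x ⁆))  ≡⟨ homogeneous-toSubset {χ = outsideColoring f a} sorted
                                                       (homOutside a)
                                                       (image⊆S (e ∪ ⁅ x ⁆)) (image⊆S (e′ ∪ ⁅ x ⁆))
                                                       (∣image-∪⁅x⁆∣ ee x∉e) (∣image-∪⁅x⁆∣ ee′ x∉e′) ⟩
      outsideColoring f a (image φ (e′ ∪ ⁅ x ⁆)) ≡⟨ outsideColoring-image ee′ x∉e′ a
                                                       (trans pos′≡pos (sym (toℕ-fromℕ< _))) ⟩
      suc (f (φ x) (edgeImage e′ ee′))            ∎)
      where
      open ≡-Reasoning
      x∉e′ = x∉e ∘ slot≡⇒∈ (uniform H e′ ee′) (sym slot≡)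
      a = fromℕ< (pos-∪⁅x⁆≤1+r {σ = σ} (uniform H e ee) x∉e)
      pos′≡pos : ∣ (e′ ∪ ⁅ x ⁆) ∩ below σ x ∣ ≡ ∣ (e ∪ ⁅ x ⁆) ∩ below σ x ∣
      pos′≡pos = ℕ.suc-injective (ℕ.+-cancelˡ-≡ r _ _
        (trans (sym (slot-∉ {σ = σ} x∉e′)) (trans (sym slot≡) (slot-∉ x∉e))))

    sameColor : f (φ x) (edgeImage e ee) ≡ f (φ x) (edgeImage e′ ee′)
    sameColor = [ sameColor-∈ , sameColor-∉ ]′ (toSum (x ∈? e))

boundedLocalColoring⇒¬twoLocallyLarge : ∀ {r h} (H : RGraph r h) →
  (Σ ℕ λ C → ∀ n → LocalColoring n H C) → ¬ TwoLocallyLarge H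
boundedLocalColoring⇒¬twoLocallyLarge {r} {h} H (C , coloring) large =
  let σ , collision = Equivalence.to (twoLocallyLarge⇔slotCollisions H) large
      f , local = coloring (localRamseyNumber r C h)
      S , sorted , ∣S∣≡h , homInside , homOutside = homogeneousSet h f
      open HomogeneousEmbedding H f sorted ∣S∣≡h homInside homOutside σ
      x , rainbow = local φ injective
      e , e′ , ee , ee′ , e≢e′ , slot≡ = collision x
  in rainbow (edgeImage e ee) (edgeImage e′ ee′) (e , ee , isImage-image φ e) (e′ , ee′ , isImage-image φ e′)
             (e≢e′ ∘ image-injective φ injective) (sameColor ee ee′ slot≡)

theorem2p2 : ∀ (r h : ℕ) (H : RGraph r h) →
    (Σ ℕ λ C → ∀ (n : ℕ) → LocalColoring n H C) ⇔ (¬ TwoLocallyLarge H)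
theorem2p2 r h H =
  mk⇔ (boundedLocalColoring⇒¬twoLocallyLarge H) (λ notLarge → suc (2 * r + 1) , slotColoring-local H notLarge)
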